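{- Let $n>0$ and integers $i,j\ge0$ with $0\le i+j<n$. Then \[ K(n,i,j)=\sum_{k=0}^{n-1}\binom{k}{i}\binom{n-1-k}{i+j-k}A(n,k). \]
   Context: A segmented permutation of size $n$ is a permutation $\sigma=\sigma_1\cdots\sigma_n$ of $\{1,\dots,n\}$, written as a word, together with a choice, for each position $i\in\{1,\dots,n-1\}$, of whether or not a bar is placed between $\sigma_i$ and $\sigma_{i+1}$. $SP_n$ is the set of these. A position $i<n$ is a segmentation if there is a bar between $\sigma_i$ and $\sigma_{i+1}$, and a descent if it is not a segmentation and $\sigma_i>\sigma_{i+1}$. $\operatorname{des}(\sigma)$ and $\operatorname{seg}(\sigma)$ are the numbers of descents and segmentations. $K(n,i,j)=\#\{\sigma\in SP_n\mid \operatorname{des}(\sigma)=i,\ \operatorname{seg}(\sigma)=j\}$. $A(n,k)$ is the Eulerian number: the number of ordinary permutations of $\{1,\dots,n\}$ with exactly $k$ descents. Binomial coefficients $\binom{a}{b}$ are $0$ when $b<0$ or $b>a$. -}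

module Defs where

open import Data.Nat using (ℕ; zero; suc; _+_; _∸_; _<ᵇ_)
open import Data.Nat.Combinatorics using (_C_)
open import Data.Bool using (Bool; true; false; if_then_else_; not; _∧_)
open import Data.Fin using (Fin; toℕ)
open import Data.Fin.Properties using (_≟_)
open import Data.List using (List; []; _∷_; length; map; filterᵇ; allFin; cartesianProduct; upTo)
open import Data.Nat.ListAction using (sum)
open import Data.Vec using (Vec; toList)
open import Data.Vec.Relation.Unary.AllPairs using (AllPairs; allPairs?)
open import Data.Product using (_×_; _,_; proj₁; proj₂)
open import Relation.Binary.PropositionalEquality using (_≢_)
open import Relation.Nullary.Decidable using (does; ¬?)

allWords : (n m : ℕ) → List (Vec (Fin n) m)
allWords n zero    = Data.Vec.[] ∷ []
allWords n (suc m) =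
  map (λ p → proj₁ p Data.Vec.∷ proj₂ p) (cartesianProduct (allFin n) (allWords n m))

allBools : (m : ℕ) → List (Vec Bool m)
allBools zero    = Data.Vec.[] ∷ []
allBools (suc m) =
  map (λ p → proj₁ p Data.Vec.∷ proj₂ p) (cartesianProduct (true ∷ false ∷ []) (allBools m))

isPermᵇ : ∀ {n} → Vec (Fin n) n → Bool
isPermᵇ σ = does (allPairs? (λ x y → ¬? (x ≟ y)) σ)

-- all permutations of size n, written as words σ₁⋯σₙ (letters in Fin n, i.e. values 0..n-1)
perms : (n : ℕ) → List (Vec (Fin n) n)
perms n = filterᵇ isPermᵇ (allWords n n)

-- Segmented permutations: a permutation word together with a bar choice
-- b : Vec Bool (n ∸ 1), where the k-th entry (k = 1..n-1) says whether
-- a bar is placed between σₖ and σₖ₊₁.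
SP : ℕ → Set
SP n = Vec (Fin n) n × Vec Bool (n ∸ 1)

allSP : (n : ℕ) → List (SP n)
allSP n = cartesianProduct (perms n) (allBools (n ∸ 1))

desL : List ℕ → List Bool → ℕ
desL (x ∷ y ∷ xs) (b ∷ bs) = (if b then 0 else (if y <ᵇ x then 1 else 0)) + desL (y ∷ xs) bs
desL _ _ = 0

segL : List Bool → ℕ
segL []       = 0
segL (b ∷ bs) = (if b then 1 else 0) + segL bs

des : ∀ {n} → SP n → ℕ
des (σ , b) = desL (map toℕ (toList σ)) (toList b)

seg : ∀ {n} → SP n → ℕ
seg (σ , b) = segL (toList b)

desPerm : ∀ {n} → Vec (Fin n) n → ℕ
desPerm σ = desL (map toℕ (toList σ)) (map (λ _ → false) (toList σ))

K : ℕ → ℕ → ℕ → ℕ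
K n i j = length (filterᵇ (λ s → does (des s Data.Nat.≟ i) ∧ does (seg s Data.Nat.≟ j)) (allSP n))

A : ℕ → ℕ → ℕ
A n k = length (filterᵇ (λ σ → does (desPerm σ Data.Nat.≟ k)) (perms n))

-- binomial with the convention C(a, b) = 0 for b < 0 (i.e. integer b);
-- b is given as a pair (p, q) meaning p - q in ℤ
binomℤ : ℕ → ℕ → ℕ → ℕ
binomℤ a p q = if q Data.Nat.≤ᵇ p then a C (p ∸ q) else 0

Σ< : ℕ → (ℕ → ℕ) → ℕ
Σ< m f = sum (map f (upTo m))

-- Fix a permutation word w of length n with d descents and a = n-1-d ascents.
-- A bar choice on w produces i descents and j segmentations exactly when it
-- keeps i of the d descents unbarred (C(d,i) ways) and bars i+j-d of the a
-- ascents (C(a, i+j-d) ways).  So the number of bar choices realising (i,j)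
-- depends only on d and equals  barChoices d a i j = C(d,i) · C(a, i+j-d).
--
-- We prove this by induction on the word: putting a new letter in front of a
-- word adds one gap, which is either barred (one more segmentation) or not (one
-- more descent iff the gap is a descent).  Both the brute-force count
-- 'barCount' and the closed form 'barChoices' satisfy this recurrence
-- ('barCount-prepend', 'barChoices-prepend'); the closed form's recurrence is
-- Pascal's rule for the two binomial factors.  Finally K(n,i,j) is a sum over
-- permutations of barChoices (des σ) (n-1-des σ) i j, and grouping the terms by
-- the value k = des σ turns it into Σₖ barChoices k (n-1-k) i j · A(n,k).
module Submission where

open import Defs
open import Data.Nat using (ℕ; _+_; _∸_; _*_; _<_)
open import Data.Nat.Combinatorics using (_C_)
open import Relation.Binary.PropositionalEquality using (_≡_)

open import Data.Nat using (zero; suc; _≤_; z≤n; s≤s; _<ᵇ_; _≤?_; _≟_)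
open import Data.Nat.Properties
  using (+-suc; +-comm; +-identityʳ; *-zeroʳ; *-identityʳ; *-distribˡ-+; *-distribʳ-+;
         m+n∸m≡n; m≤m+n; ≤-reflexive; ≤-trans; ≰⇒>; suc-injective; +-commutativeSemigroup)
open import Data.Nat.Combinatorics using (nCk+nC[k+1]≡[n+1]C[k+1]; k>n⇒nCk≡0)
open import Algebra.Properties.CommutativeSemigroup +-commutativeSemigroup using (interchange)
open import Data.Bool using (Bool; true; false; if_then_else_; _∧_)
open import Data.Bool.Properties using (∧-zeroʳ)
open import Data.List using (List; []; _∷_; length; map; filterᵇ; cartesianProduct; upTo; _++_)
open import Data.List.Properties using (length-map; length-++; filter-++; map-cong; map-applyUpTo)
open import Data.Nat.ListAction using (sum)
open import Data.Vec using (Vec; toList)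
open import Data.Vec.Properties using (length-toList)
open import Data.Fin using (Fin; toℕ)
open import Data.Product using (_×_; _,_)
open import Relation.Nullary using (yes; no)
open import Relation.Nullary.Decidable using (does; T?)
open import Relation.Binary.PropositionalEquality using (refl; sym; trans; cong; cong₂; module ≡-Reasoning)
open ≡-Reasoning

count : {X : Set} → (X → Bool) → List X → ℕ
count p xs = length (filterᵇ p xs)

indicator : Bool → ℕ
indicator b = if b then 1 else 0

count-∷ : {X : Set} (p : X → Bool) (x : X) (xs : List X) →
          count p (x ∷ xs) ≡ indicator (p x) + count p xs
count-∷ p x xs with p x
... | true  = refl
... | false = refl

count-++ : {X : Set} (p : X → Bool) (xs ys : List X) →
           count p (xs ++ ys) ≡ count p xs + count p ys
count-++ p xs ys =
  trans (cong length (filter-++ (λ x → T? (p x)) xs ys)) (length-++ (filterᵇ p xs))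

count-map : {X Y : Set} (p : Y → Bool) (f : X → Y) (xs : List X) →
            count p (map f xs) ≡ count (λ x → p (f x)) xs
count-map p f []       = refl
count-map p f (x ∷ xs) = begin
  count p (f x ∷ map f xs)                         ≡⟨ count-∷ p (f x) (map f xs) ⟩
  indicator (p (f x)) + count p (map f xs)         ≡⟨ cong (indicator (p (f x)) +_) (count-map p f xs) ⟩
  indicator (p (f x)) + count (λ x → p (f x)) xs   ≡⟨ count-∷ (λ x → p (f x)) x xs ⟨
  count (λ x → p (f x)) (x ∷ xs)                   ∎

count-none : {X : Set} (p : X → Bool) → (∀ x → p x ≡ false) → (xs : List X) → count p xs ≡ 0
count-none p never []       = refl
count-none p never (x ∷ xs) = trans (count-∷ p x xs) (cong₂ (λ b c → indicator b + c) (never x) (count-none p never xs))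

count-cartesianProduct : {X Y : Set} (p : X × Y → Bool) (xs : List X) (ys : List Y) →
  count p (cartesianProduct xs ys) ≡ sum (map (λ x → count (λ y → p (x , y)) ys) xs)
count-cartesianProduct p []       ys = refl
count-cartesianProduct p (x ∷ xs) ys =
  trans (count-++ p (map (x ,_) ys) (cartesianProduct xs ys))
        (cong₂ _+_ (count-map p (x ,_) ys) (count-cartesianProduct p xs ys))

Σ<-suc : (n : ℕ) (f : ℕ → ℕ) → Σ< (suc n) f ≡ f 0 + Σ< n (λ k → f (suc k))
Σ<-suc n f = cong (λ xs → f 0 + sum xs)
  (trans (map-applyUpTo suc f n) (sym (map-applyUpTo (λ k → k) (λ k → f (suc k)) n)))

Σ<-cong : (n : ℕ) {f g : ℕ → ℕ} → (∀ k → f k ≡ g k) → Σ< n f ≡ Σ< n g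
Σ<-cong n f≗g = cong sum (map-cong f≗g (upTo n))

Σ<-zero : (n : ℕ) → Σ< n (λ _ → 0) ≡ 0
Σ<-zero zero    = refl
Σ<-zero (suc n) = trans (Σ<-suc n (λ _ → 0)) (Σ<-zero n)

Σ<-+ : (n : ℕ) (f g : ℕ → ℕ) → Σ< n (λ k → f k + g k) ≡ Σ< n f + Σ< n g
Σ<-+ zero    f g = refl
Σ<-+ (suc n) f g = begin
  Σ< (suc n) (λ k → f k + g k)
    ≡⟨ Σ<-suc n (λ k → f k + g k) ⟩
  (f 0 + g 0) + Σ< n (λ k → f (suc k) + g (suc k))
    ≡⟨ cong ((f 0 + g 0) +_) (Σ<-+ n (λ k → f (suc k)) (λ k → g (suc k))) ⟩
  (f 0 + g 0) + (Σ< n (λ k → f (suc k)) + Σ< n (λ k → g (suc k)))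
    ≡⟨ interchange (f 0) (g 0) _ _ ⟩
  (f 0 + Σ< n (λ k → f (suc k))) + (g 0 + Σ< n (λ k → g (suc k)))
    ≡⟨ cong₂ _+_ (Σ<-suc n f) (Σ<-suc n g) ⟨
  Σ< (suc n) f + Σ< (suc n) g ∎

Σ<-select : (n d : ℕ) (g : ℕ → ℕ) → d < n → Σ< n (λ k → g k * indicator (does (d ≟ k))) ≡ g d
Σ<-select (suc n) zero g _ = begin
  Σ< (suc n) (λ k → g k * indicator (does (0 ≟ k)))  ≡⟨ Σ<-suc n _ ⟩
  g 0 * 1 + Σ< n (λ k → g (suc k) * 0)               ≡⟨ cong₂ _+_ (*-identityʳ (g 0)) (Σ<-cong n (λ k → *-zeroʳ (g (suc k)))) ⟩
  g 0 + Σ< n (λ _ → 0)                               ≡⟨ cong (g 0 +_) (Σ<-zero n) ⟩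
  g 0 + 0                                            ≡⟨ +-identityʳ (g 0) ⟩
  g 0                                                ∎
Σ<-select (suc n) (suc d) g (s≤s d<n) = begin
  Σ< (suc n) (λ k → g k * indicator (does (suc d ≟ k)))       ≡⟨ Σ<-suc n _ ⟩
  g 0 * 0 + Σ< n (λ k → g (suc k) * indicator (does (d ≟ k))) ≡⟨ cong (_+ Σ< n (λ k → g (suc k) * indicator (does (d ≟ k)))) (*-zeroʳ (g 0)) ⟩
  Σ< n (λ k → g (suc k) * indicator (does (d ≟ k)))           ≡⟨ Σ<-select n d (λ k → g (suc k)) d<n ⟩
  g (suc d)                                                   ∎

sum-by-value : {X : Set} (n : ℕ) (d : X → ℕ) (g : ℕ → ℕ) (L : List X) → (∀ x → d x < n) →
  sum (map (λ x → g (d x)) L) ≡ Σ< n (λ k → g k * count (λ x → does (d x ≟ k)) L)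
sum-by-value n d g [] _ = sym (trans (Σ<-cong n (λ k → *-zeroʳ (g k))) (Σ<-zero n))
sum-by-value n d g (x ∷ L) d<n = sym (begin
  Σ< n (λ k → g k * count (λ y → does (d y ≟ k)) (x ∷ L))
    ≡⟨ Σ<-cong n (λ k → trans (cong (g k *_) (count-∷ _ x L)) (*-distribˡ-+ (g k) _ _)) ⟩
  Σ< n (λ k → g k * indicator (does (d x ≟ k)) + g k * count (λ y → does (d y ≟ k)) L)
    ≡⟨ Σ<-+ n _ _ ⟩
  Σ< n (λ k → g k * indicator (does (d x ≟ k))) + Σ< n (λ k → g k * count (λ y → does (d y ≟ k)) L)
    ≡⟨ cong₂ _+_ (Σ<-select n (d x) g (d<n x)) (sym (sum-by-value n d g L d<n)) ⟩
  g (d x) + sum (map (λ y → g (d y)) L) ∎)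

binomℤ-shift : (c p q : ℕ) → binomℤ c (suc p) (suc q) ≡ binomℤ c p q
binomℤ-shift c p zero    = refl
binomℤ-shift c p (suc q) = refl

binomℤ-negative : (c p q : ℕ) → p < q → binomℤ c p q ≡ 0
binomℤ-negative c zero    (suc q) _         = refl
binomℤ-negative c (suc p) (suc q) (s≤s p<q) = trans (binomℤ-shift c p q) (binomℤ-negative c p q p<q)

-- For p - q ≤ 0 the value C(c, p - q) ∈ {0, 1} does not depend on c.
binomℤ-nonpositive : (c p q : ℕ) → p ≤ q → binomℤ (suc c) p q ≡ binomℤ c p q
binomℤ-nonpositive c zero    zero    _         = refl
binomℤ-nonpositive c zero    (suc q) _         = refl
binomℤ-nonpositive c (suc p) (suc q) (s≤s p≤q) =
  trans (binomℤ-shift (suc c) p q) (trans (binomℤ-nonpositive c p q p≤q) (sym (binomℤ-shift c p q)))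

binomℤ-pascal : (c p q : ℕ) → binomℤ (suc c) (suc p) q ≡ binomℤ c p q + binomℤ c (suc p) q
binomℤ-pascal c p zero = sym (nCk+nC[k+1]≡[n+1]C[k+1] c p)
binomℤ-pascal c zero (suc q) = begin
  binomℤ (suc c) 1 (suc q)          ≡⟨ binomℤ-shift (suc c) 0 q ⟩
  binomℤ (suc c) 0 q                ≡⟨ binomℤ-nonpositive c 0 q z≤n ⟩
  binomℤ c 0 q                      ≡⟨ binomℤ-shift c 0 q ⟨
  binomℤ c 1 (suc q)                ∎
binomℤ-pascal c (suc p) (suc q) = begin
  binomℤ (suc c) (suc (suc p)) (suc q)          ≡⟨ binomℤ-shift (suc c) (suc p) q ⟩
  binomℤ (suc c) (suc p) q                      ≡⟨ binomℤ-pascal c p q ⟩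
  binomℤ c p q + binomℤ c (suc p) q             ≡⟨ cong₂ _+_ (binomℤ-shift c p q) (binomℤ-shift c (suc p) q) ⟨
  binomℤ c (suc p) (suc q) + binomℤ c (suc (suc p)) (suc q) ∎

barChoices : ℕ → ℕ → ℕ → ℕ → ℕ
barChoices d a i j = (d C i) * binomℤ a (i + j) d

shiftDown : (ℕ → ℕ) → ℕ → ℕ
shiftDown f zero    = 0
shiftDown f (suc k) = f k

shiftDown-cong : {f g : ℕ → ℕ} → (∀ k → f k ≡ g k) → (k : ℕ) → shiftDown f k ≡ shiftDown g k
shiftDown-cong f≗g zero    = refl
shiftDown-cong f≗g (suc k) = f≗g k

-- An extra ascent gap is either barred or remains an ascent.
barChoices-ascent : (d a i j : ℕ) →
  barChoices d (suc a) i j ≡ shiftDown (barChoices d a i) j + barChoices d a i j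
barChoices-ascent d a i zero rewrite +-identityʳ i with i ≤? d
... | yes i≤d = cong ((d C i) *_) (binomℤ-nonpositive a i d i≤d)
... | no  i≰d rewrite k>n⇒nCk≡0 (≰⇒> i≰d) = refl
barChoices-ascent d a i (suc j) rewrite +-suc i j =
  trans (cong ((d C i) *_) (binomℤ-pascal a (i + j) d)) (*-distribˡ-+ (d C i) _ _)

-- C(d+1, i+1) C(a, i-d) = C(d, i) C(a, i-d), since the other Pascal term vanishes.
barChoices-descent-unbarred : (d a i : ℕ) → barChoices (suc d) a (suc i) 0 ≡ barChoices d a i 0
barChoices-descent-unbarred d a i rewrite +-identityʳ i | binomℤ-shift a i d = begin
  (suc d C suc i) * binomℤ a i d                              ≡⟨ cong (_* binomℤ a i d) (nCk+nC[k+1]≡[n+1]C[k+1] d i) ⟨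
  (d C i + d C suc i) * binomℤ a i d                          ≡⟨ *-distribʳ-+ (binomℤ a i d) (d C i) (d C suc i) ⟩
  (d C i) * binomℤ a i d + (d C suc i) * binomℤ a i d         ≡⟨ cong ((d C i) * binomℤ a i d +_) vanishing ⟩
  (d C i) * binomℤ a i d + 0                                  ≡⟨ +-identityʳ _ ⟩
  (d C i) * binomℤ a i d                                      ∎
  where
  vanishing : (d C suc i) * binomℤ a i d ≡ 0
  vanishing with suc i ≤? d
  ... | yes i<d rewrite binomℤ-negative a i d i<d = *-zeroʳ (d C suc i)
  ... | no  i≮d rewrite k>n⇒nCk≡0 (≰⇒> i≮d) = refl

-- An extra descent gap is either barred or remains a descent.
barChoices-descent : (d a i j : ℕ) →
  barChoices (suc d) a i j ≡ shiftDown (barChoices d a i) j + shiftDown (λ i′ → barChoices d a i′ j) i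
barChoices-descent d a zero    zero    = refl
barChoices-descent d a zero    (suc j) = trans (cong (1 *_) (binomℤ-shift a j d)) (sym (+-identityʳ _))
barChoices-descent d a (suc i) zero    = barChoices-descent-unbarred d a i
barChoices-descent d a (suc i) (suc j) rewrite +-suc i j | binomℤ-shift a (suc (i + j)) d = begin
  (suc d C suc i) * B                   ≡⟨ cong (_* B) (nCk+nC[k+1]≡[n+1]C[k+1] d i) ⟨
  (d C i + d C suc i) * B               ≡⟨ *-distribʳ-+ B (d C i) (d C suc i) ⟩
  (d C i) * B + (d C suc i) * B         ≡⟨ +-comm ((d C i) * B) _ ⟩
  (d C suc i) * B + (d C i) * B         ∎
  where
  B : ℕ
  B = binomℤ a (suc (i + j)) d

-- Given the counts c i j for a word, the counts after prepending a gap that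
-- is a descent (g = true) or an ascent (g = false): the gap is either barred
-- (one more segmentation) or unbarred (one more descent iff g).
prependGap : Bool → (ℕ → ℕ → ℕ) → ℕ → ℕ → ℕ
prependGap g c i j = shiftDown (c i) j + (if g then shiftDown (λ i′ → c i′ j) i else c i j)

prependGap-cong : (g : Bool) {c c′ : ℕ → ℕ → ℕ} → (∀ i j → c i j ≡ c′ i j) →
                  (i j : ℕ) → prependGap g c i j ≡ prependGap g c′ i j
prependGap-cong true  c≗c′ i j = cong₂ _+_ (shiftDown-cong (c≗c′ i) j) (shiftDown-cong (λ i′ → c≗c′ i′ j) i)
prependGap-cong false c≗c′ i j = cong₂ _+_ (shiftDown-cong (c≗c′ i) j) (c≗c′ i j)

barChoices-prepend : (g : Bool) (d a i j : ℕ) →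
  prependGap g (barChoices d a) i j ≡ barChoices (indicator g + d) ((if g then 0 else 1) + a) i j
barChoices-prepend true  d a i j = sym (barChoices-descent d a i j)
barChoices-prepend false d a i j = sym (barChoices-ascent d a i j)

descents : List ℕ → ℕ
descents (x ∷ y ∷ xs) = indicator (y <ᵇ x) + descents (y ∷ xs)
descents _            = 0

ascents : List ℕ → ℕ
ascents (x ∷ y ∷ xs) = (if y <ᵇ x then 0 else 1) + ascents (y ∷ xs)
ascents _            = 0

descents+ascents : (xs : List ℕ) (m : ℕ) → length xs ≡ suc m → descents xs + ascents xs ≡ m
descents+ascents (x ∷ [])     zero    _ = refl
descents+ascents (x ∷ y ∷ xs) (suc m) len with y <ᵇ x | descents+ascents (y ∷ xs) m (suc-injective len)
... | true  | ih = cong suc ih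
... | false | ih = trans (+-suc (descents (y ∷ xs)) _) (cong suc ih)

desL-noBars : {X : Set} (xs : List ℕ) (ys : List X) → length xs ≡ length ys →
              desL xs (map (λ _ → false) ys) ≡ descents xs
desL-noBars []           ys           _   = refl
desL-noBars (x ∷ [])     ys           _   = refl
desL-noBars (x ∷ y ∷ xs) (_ ∷ z ∷ ys) len =
  cong (indicator (y <ᵇ x) +_) (desL-noBars (y ∷ xs) (z ∷ ys) (suc-injective len))

barCount : List ℕ → ℕ → ℕ → ℕ → ℕ
barCount xs m i j = count (λ b → does (desL xs (toList b) ≟ i) ∧ does (segL (toList b) ≟ j)) (allBools m)

-- Splitting the bar choices according to the first gap (allBools (suc m) is
-- true ∷ _ and false ∷ _ over allBools m; the product count ends in '+ 0').
barCount-prepend : (x y : ℕ) (xs : List ℕ) (m i j : ℕ) →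
  barCount (x ∷ y ∷ xs) (suc m) i j ≡ prependGap (y <ᵇ x) (barCount (y ∷ xs) m) i j
barCount-prepend x y xs m i j =
  trans (count-map _ _ (cartesianProduct (true ∷ false ∷ []) (allBools m)))
  (trans (count-cartesianProduct _ (true ∷ false ∷ []) (allBools m))
         (cong₂ _+_ (barred j) (trans (+-identityʳ _) (unbarred (y <ᵇ x) i))))
  where
  -- A barred first gap adds one segmentation and no descent.
  barred : (j : ℕ) →
    count (λ b → does (desL (y ∷ xs) (toList b) ≟ i) ∧ does (suc (segL (toList b)) ≟ j)) (allBools m)
      ≡ shiftDown (barCount (y ∷ xs) m i) j
  barred zero    = count-none _ (λ b → ∧-zeroʳ (does (desL (y ∷ xs) (toList b) ≟ i))) (allBools m)
  barred (suc j) = refl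
  -- An unbarred first gap adds a descent exactly when it is one.
  unbarred : (g : Bool) (i : ℕ) →
    count (λ b → does (indicator g + desL (y ∷ xs) (toList b) ≟ i) ∧ does (segL (toList b) ≟ j)) (allBools m)
      ≡ (if g then shiftDown (λ i′ → barCount (y ∷ xs) m i′ j) i else barCount (y ∷ xs) m i j)
  unbarred true  zero    = count-none _ (λ b → refl) (allBools m)
  unbarred true  (suc i) = refl
  unbarred false i       = refl

barCount-closed : (xs : List ℕ) (m : ℕ) → length xs ≡ suc m →
  (i j : ℕ) → barCount xs m i j ≡ barChoices (descents xs) (ascents xs) i j
barCount-closed (x ∷ [])     zero    _   zero    zero    = refl
barCount-closed (x ∷ [])     zero    _   zero    (suc j) = refl
barCount-closed (x ∷ [])     zero    _   (suc i) j       = refl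
barCount-closed (x ∷ y ∷ xs) (suc m) len i       j       = begin
  barCount (x ∷ y ∷ xs) (suc m) i j
    ≡⟨ barCount-prepend x y xs m i j ⟩
  prependGap (y <ᵇ x) (barCount (y ∷ xs) m) i j
    ≡⟨ prependGap-cong (y <ᵇ x) (barCount-closed (y ∷ xs) m (suc-injective len)) i j ⟩
  prependGap (y <ᵇ x) (barChoices (descents (y ∷ xs)) (ascents (y ∷ xs))) i j
    ≡⟨ barChoices-prepend (y <ᵇ x) (descents (y ∷ xs)) (ascents (y ∷ xs)) i j ⟩
  barChoices (descents (x ∷ y ∷ xs)) (ascents (x ∷ y ∷ xs)) i j ∎

letters : {n : ℕ} → Vec (Fin n) n → List ℕ
letters σ = map toℕ (toList σ)

length-letters : {n : ℕ} (σ : Vec (Fin n) n) → length (letters σ) ≡ n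
length-letters σ = trans (length-map toℕ (toList σ)) (length-toList σ)

desPerm-descents : {n : ℕ} (σ : Vec (Fin n) n) → desPerm σ ≡ descents (letters σ)
desPerm-descents σ = desL-noBars (letters σ) (toList σ) (length-map toℕ (toList σ))

module _ {m : ℕ} (σ : Vec (Fin (suc m)) (suc m)) where

  private
    gaps : descents (letters σ) + ascents (letters σ) ≡ m
    gaps = descents+ascents (letters σ) m (length-letters σ)

  ascents-perm : ascents (letters σ) ≡ m ∸ desPerm σ
  ascents-perm = begin
    ascents (letters σ)                                                   ≡⟨ m+n∸m≡n (descents (letters σ)) _ ⟨
    (descents (letters σ) + ascents (letters σ)) ∸ descents (letters σ)   ≡⟨ cong₂ _∸_ gaps (sym (desPerm-descents σ)) ⟩
    m ∸ desPerm σ                                                         ∎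

  desPerm-bound : desPerm σ < suc m
  desPerm-bound rewrite desPerm-descents σ = s≤s (≤-trans (m≤m+n _ _) (≤-reflexive gaps))

  barCount-perm : (i j : ℕ) → barCount (letters σ) m i j ≡ barChoices (desPerm σ) (m ∸ desPerm σ) i j
  barCount-perm i j =
    trans (barCount-closed (letters σ) m (length-letters σ) i j)
          (cong₂ (λ d a → barChoices d a i j) (sym (desPerm-descents σ)) ascents-perm)

mainTheorem5 : (n i j : ℕ) → 0 < n → i + j < n →
    K n i j ≡ Σ< n (λ k → (k C i) * binomℤ (n ∸ 1 ∸ k) (i + j) k * A n k)
mainTheorem5 (suc m) i j _ _ = begin
  K (suc m) i j
    ≡⟨ count-cartesianProduct _ (perms (suc m)) (allBools m) ⟩
  sum (map (λ σ → barCount (letters σ) m i j) (perms (suc m)))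
    ≡⟨ cong sum (map-cong (λ σ → barCount-perm σ i j) (perms (suc m))) ⟩
  sum (map (λ σ → choices (desPerm σ)) (perms (suc m)))
    ≡⟨ sum-by-value (suc m) desPerm choices (perms (suc m)) desPerm-bound ⟩
  Σ< (suc m) (λ k → choices k * A (suc m) k) ∎
  where
  choices : ℕ → ℕ
  choices k = barChoices k (m ∸ k) i j
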